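{- Let $k$ be a positive integer. The class $\mathsf{SHD}_k$ is closed under pumping and under local merging. The class $\mathsf{HD}_k$ is closed under local merging but not under pumping.
   Context: A hypergraph is a triple $(V,E,\beta)$ with disjoint finite sets $V,E$ and total $\beta\colon E\to\mathcal{P}(V)$ with $V=\bigcup_e\beta(e)$; its incidence graph has red vertices $V$, blue vertices $E$, edges $(e,v)$ for $v\in\beta(e)$. A class $\mathfrak{C}$ of hypergraphs is closed under pumping if for every $\mathcal{H}\in\mathfrak{C}$, every hypergraph obtained from $\mathcal{H}$ by adding a new vertex to the content of exactly one (arbitrary) hyperedge is in $\mathfrak{C}$; it is closed under local merging if for every $\mathcal{H}\in\mathfrak{C}$, every hypergraph obtained by choosing a hyperedge $e$ and two distinct vertices $u,v\in\beta(e)$ and identifying $u$ with $v$ (in all hyperedges) is in $\mathfrak{C}$. For a rooted forest $F$: $\le_F$ the tree order (roots minimal), $P(s,t)$ the node set of the path from $s$ to $t$ (empty if none), $P(s)$ the path to the root, $\mathrm{lcv}(s,t)$ the $\le_F$-maximum of $P(s)\cap P(t)$ (defined iff same tree), height = maximal $|P(s)|$. An elimination forest of a hypergraph $\mathcal{H}$ is $(F,\Gamma)$ with $\Gamma\colon V(F)\to E(\mathcal{H})$ such that, with $\hat\Gamma(t)=\beta(\Gamma(t))$: (1) every vertex lies in some $\hat\Gamma(t)$; (2) for every hyperedge $e$ there are $s\le_F t$ with $\beta(e)\subseteq\bigcup_{p\in P(s,t)}\hat\Gamma(p)$; (3) if $\hat\Gamma(s)\cap\hat\Gamma(t)\neq\emptyset$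 then $\mathrm{lcv}(s,t)$ is defined and $\hat\Gamma(s)\cap\hat\Gamma(t)\subseteq\bigcup_{p\in P(\mathrm{lcv}(s,t))}\hat\Gamma(p)$. It is strict if $\Gamma$ is bijective. $\mathsf{HD}_k$ ($\mathsf{SHD}_k$) is the class of hypergraphs having an elimination forest (strict elimination forest) of height at most $k$. -}

module Defs where

open import Data.Nat using (ℕ; zero; suc)
open import Data.Fin using (Fin; zero; suc; _≟_)
import Data.Fin as Fin
open import Data.Fin.Subset using (Subset; _∈_; inside; outside)
open import Data.Vec using (_∷_; here; there)
open import Data.Maybe using (Maybe; just; nothing; _>>=_)
open import Data.Product using (Σ; _×_; _,_; ∃; ∃-syntax)
open import Data.Sum using (_⊎_)
open import Data.Bool using (if_then_else_)
open import Relation.Nullary using (¬_; yes; no)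
open import Relation.Nullary.Decidable using (⌊_⌋)
open import Relation.Binary.PropositionalEquality using (_≡_; _≢_; refl; subst; sym)
open import Function.Bundles using (_⇔_)

-- Hypergraphs.  Vertex set V = Fin n, hyperedge set E = Fin m
-- (disjoint by construction), content β e ⊆ V, and V = ⋃ β(e).

record Hypergraph (n m : ℕ) : Set where
  field
    β     : Fin m → Subset n
    cover : ∀ (v : Fin n) → ∃[ e ] (v ∈ β e)
open Hypergraph public

Class : Set₁
Class = ∀ {n m} → Hypergraph n m → Set

-- Pumping: add a new vertex (here: the vertex zero, old vertices are
-- shifted by suc) to the content of exactly the hyperedge e₀.

private
  self∈ : ∀ {m} (e₀ : Fin m) → (if ⌊ e₀ ≟ e₀ ⌋ then inside else outside) ≡ inside
  self∈ e₀ with e₀ ≟ e₀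
  ... | yes _ = refl
  ... | no ne = Data.Empty.⊥-elim (ne refl)
    where import Data.Empty

pump : ∀ {n m} → Hypergraph n m → Fin m → Hypergraph (ℕ.suc n) m
pump {n} {m} H e₀ = record { β = β' ; cover = cov }
  where
  β' : Fin m → Subset (ℕ.suc n)
  β' e = (if ⌊ e ≟ e₀ ⌋ then inside else outside) ∷ β H e
  cov : ∀ v → ∃[ e ] (v ∈ β' e)
  cov zero = e₀ , subst (λ b → Fin.zero ∈ (b ∷ β H e₀)) (sym (self∈ e₀)) here
  cov (suc v) with cover H v
  ... | e , v∈ = e , there v∈

ClosedUnderPumping : Class → Set
ClosedUnderPumping C =
  ∀ {n m} (H : Hypergraph n m) → C H → (e : Fin m) → C (pump H e)

-- Local merging: H' (same hyperedge set) arises from H by choosing a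
-- hyperedge e and distinct u, v ∈ β(e) and identifying u with v in all
-- hyperedges.  The identification is a surjection f : V(H) → V(H')
-- whose only non-trivial fibre is {u, v}; contents are images under f.

IsLocalMerge : ∀ {n n' m} → Hypergraph n m → Hypergraph n' m → Set
IsLocalMerge {n} {n'} {m} H H' =
  Σ (Fin m) λ e → Σ (Fin n) λ u → Σ (Fin n) λ v →
    u ≢ v × u ∈ β H e × v ∈ β H e ×
    Σ (Fin n → Fin n') λ f →
        (∀ x y → (f x ≡ f y) ⇔ (x ≡ y ⊎ ((x ≡ u × y ≡ v) ⊎ (x ≡ v × y ≡ u))))
      × (∀ w → ∃[ x ] (f x ≡ w))
      × (∀ e' w → (w ∈ β H' e') ⇔ (∃[ x ] (x ∈ β H e' × f x ≡ w)))

ClosedUnderLocalMerging : Class → Set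
ClosedUnderLocalMerging C =
  ∀ {n n' m} (H : Hypergraph n m) (H' : Hypergraph n' m) →
    C H → IsLocalMerge H H' → C H'

-- Rooted forests on node set Fin p, given by a parent function
-- (roots have parent nothing), without cycles.

anc : ∀ {p} → (Fin p → Maybe (Fin p)) → ℕ → Fin p → Maybe (Fin p)
anc par zero    t = just t
anc par (ℕ.suc d) t = anc par d t >>= par

IsForest : ∀ {p} → (Fin p → Maybe (Fin p)) → Set
IsForest {p} par = ∀ (t : Fin p) → ∃[ d ] (anc par d t ≡ nothing)

_⊢_≤F_ : ∀ {p} → (Fin p → Maybe (Fin p)) → Fin p → Fin p → Set
par ⊢ s ≤F t = ∃[ d ] (anc par d t ≡ just s)

IsLcv : ∀ {p} → (Fin p → Maybe (Fin p)) → Fin p → Fin p → Fin p → Set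
IsLcv par s t l =
  (par ⊢ l ≤F s) × (par ⊢ l ≤F t) ×
  (∀ q → par ⊢ q ≤F s → par ⊢ q ≤F t → par ⊢ q ≤F l)

-- Height ≤ k: every root path P(t) has at most k nodes, i.e. the
-- ancestor at distance k of every node does not exist.
HeightAtMost : ∀ {p} → (Fin p → Maybe (Fin p)) → ℕ → Set
HeightAtMost {p} par k = ∀ (t : Fin p) → anc par k t ≡ nothing

record EliminationForest {n m} (H : Hypergraph n m) : Set where
  field
    p      : ℕ
    parent : Fin p → Maybe (Fin p)
    forest : IsForest parent
    Γ      : Fin p → Fin m
  Γ̂ : Fin p → Subset n
  Γ̂ t = β H (Γ t)
  field
    cond1 : ∀ (v : Fin n) → ∃[ t ] (v ∈ Γ̂ t)
    cond2 : ∀ (e : Fin m) → ∃[ s ] ∃[ t ] (parent ⊢ s ≤F t ×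
              (∀ v → v ∈ β H e → ∃[ q ] (parent ⊢ s ≤F q × parent ⊢ q ≤F t × v ∈ Γ̂ q)))
    cond3 : ∀ (s t : Fin p) → (∃[ v ] (v ∈ Γ̂ s × v ∈ Γ̂ t)) →
              ∃[ l ] (IsLcv parent s t l ×
                (∀ v → v ∈ Γ̂ s → v ∈ Γ̂ t → ∃[ q ] (parent ⊢ q ≤F l × v ∈ Γ̂ q)))
open EliminationForest public

IsStrict : ∀ {n m} {H : Hypergraph n m} → EliminationForest H → Set
IsStrict {m = m} F =
  (∀ a b → Γ F a ≡ Γ F b → a ≡ b) × (∀ (e : Fin m) → ∃[ t ] (Γ F t ≡ e))

HD : ℕ → Class
HD k H = ∃[ F ] HeightAtMost (parent {H = H} F) k

SHD : ℕ → Class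
SHD k H = ∃[ F ] (IsStrict {H = H} F × HeightAtMost (parent {H = H} F) k)

-- The same elimination forest survives both operations.  After a local merge of u, v ∈ β(e),
-- a vertex shared by Γ̂(s) and Γ̂(t) either was shared before, or comes from u ∈ Γ̂(s) and v ∈ Γ̂(t); then
-- condition (2) for e puts the nodes covering u and v on one root path, which yields a common
-- ancestor of s and t below which u or v is covered.  After pumping e, a strict forest already
-- has a node labelled e to cover the new vertex.
-- A non-strict forest may leave e unused.  Take the hyperedges 0, …, k and the vertices (i, j),
-- where (i, j) lies in the hyperedges i and j, and (0, 0) lies in every hyperedge: the chain
-- labelled 1, …, k is an elimination forest of height k.  After pumping 0, every hyperedge has a
-- private vertex and any two hyperedges share a vertex of their own, so every label occurs and
-- any two nodes have a common ancestor carrying one of their labels; hence a single root path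
-- carries all k + 1 labels.

module Submission where

open import Defs
open import Data.Nat using (ℕ; _≤_)
open import Data.Product using (_×_)
open import Relation.Nullary using (¬_)

open import Data.Nat using (zero; suc; _+_; _*_; _∸_; _<_; z≤n; s≤s⁻¹)
open import Data.Nat.Properties
  using (+-comm; +-suc; +-identityʳ; suc-injective; ≤-refl; ≤-total; <-≤-trans;
         ≮⇒≥; ≰⇒>; <-irrefl; m∸n+n≡m; m+[n∸m]≡n; anyUpTo?)
open import Data.Fin using (Fin; zero; suc; toℕ; fromℕ; fromℕ<; inject₁; combine; remQuot; _≟_)
open import Data.Fin.Properties
  using (toℕ-injective; toℕ-inject₁; toℕ<n; ≤fromℕ; fromℕ<-injective; remQuot-combine;
         any?; injective⇒≤)
open import Data.Fin.Subset using (Subset; _∈_)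
open import Data.Vec using (here; there; tabulate)
open import Data.Vec.Properties using (lookup∘tabulate; []=⇒lookup; lookup⇒[]=)
open import Data.Maybe using (Maybe; just; nothing; _>>=_)
open import Data.Maybe.Properties using (just-injective; ≡-dec)
open import Data.Bool using (true)
open import Data.List using ([]; _∷_; allFin)
open import Data.List.Relation.Unary.All as All using (All; []; _∷_)
open import Data.List.Membership.Propositional.Properties using (∈-allFin)
open import Data.Product using (_,_; ∃-syntax; proj₁; proj₂)
open import Data.Sum using (_⊎_; inj₁; inj₂; [_,_]′; reduce)
open import Data.Empty using (⊥-elim)
open import Function.Bundles using (_⇔_; mk⇔; Equivalence)
open import Function.Definitions using (Injective)
open import Relation.Nullary using (Dec; yes; no; contradiction)
open import Relation.Nullary.Decidable using (does; map′; dec-true; _×-dec_; _⊎-dec_)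
open import Relation.Binary.PropositionalEquality
  using (_≡_; refl; sym; trans; cong; subst; module ≡-Reasoning)

open Equivalence using (to; from)

least-witness : {P : ℕ → Set} → (∀ d → Dec (P d)) →
  ∀ {n} → P n → ∃[ d ] (P d × (∀ {e} → e < d → ¬ P e))
least-witness {P} P? {n} pn = below (suc n) (n , ≤-refl , pn)
  where
  below : ∀ b → ∃[ e ] (e < b × P e) → ∃[ d ] (P d × (∀ {e} → e < d → ¬ P e))
  below (suc b) (e , e<1+b , pe) with anyUpTo? P? b
  ... | yes smaller = below b smaller
  ... | no none = e , pe , λ e'<e pe' → none (_ , <-≤-trans e'<e (s≤s⁻¹ e<1+b) , pe')

module Forest {p : ℕ} (par : Fin p → Maybe (Fin p)) where

  anc-+ : ∀ d e t → anc par (d + e) t ≡ (anc par e t >>= anc par d)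
  anc-+ zero e t with anc par e t
  ... | nothing = refl
  ... | just _ = refl
  anc-+ (suc d) e t rewrite anc-+ d e t with anc par e t
  ... | nothing = refl
  ... | just _ = refl

  anc-suc : ∀ d t → anc par (suc d) t ≡ (par t >>= anc par d)
  anc-suc d t = trans (cong (λ x → anc par x t) (+-comm 1 d)) (anc-+ d 1 t)

  anc-via : ∀ {d e t a} → anc par e t ≡ just a → anc par (d + e) t ≡ anc par d a
  anc-via {d} {e} {t} eq rewrite anc-+ d e t | eq = refl

  anc-beyond-root : ∀ {D d t} → anc par D t ≡ nothing → D ≤ d → anc par d t ≡ nothing
  anc-beyond-root {D} {d} {t} eq D≤d =
    subst (λ x → anc par x t ≡ nothing) (m∸n+n≡m D≤d)
      (trans (anc-+ (d ∸ D) D t) (cong (_>>= anc par (d ∸ D)) eq))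

  ≤F-refl : ∀ t → par ⊢ t ≤F t
  ≤F-refl t = 0 , refl

  ≤F-trans : ∀ {a b c} → par ⊢ a ≤F b → par ⊢ b ≤F c → par ⊢ a ≤F c
  ≤F-trans (d , b↦a) (e , c↦b) = d + e , trans (anc-via {d} c↦b) b↦a

  ≤F-by-distance : ∀ {d e t a b} → anc par e t ≡ just a → anc par d t ≡ just b → e ≤ d →
    par ⊢ b ≤F a
  ≤F-by-distance {d} {e} {t} t↦a t↦b e≤d =
    d ∸ e , trans (sym (anc-via {d ∸ e} t↦a)) (trans (cong (λ x → anc par x t) (m∸n+n≡m e≤d)) t↦b)

  ≤F-total-below : ∀ {a b z} → par ⊢ a ≤F z → par ⊢ b ≤F z → par ⊢ a ≤F b ⊎ par ⊢ b ≤F a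
  ≤F-total-below (d , z↦a) (e , z↦b) with ≤-total d e
  ... | inj₁ d≤e = inj₂ (≤F-by-distance z↦a z↦b d≤e)
  ... | inj₂ e≤d = inj₁ (≤F-by-distance z↦b z↦a e≤d)

  ≤F-total-below₂ : ∀ {a b qa qb z} → par ⊢ a ≤F qa → par ⊢ b ≤F qb →
    par ⊢ qa ≤F z → par ⊢ qb ≤F z → par ⊢ a ≤F b ⊎ par ⊢ b ≤F a
  ≤F-total-below₂ a≤qa b≤qb qa≤z qb≤z with ≤F-total-below qa≤z qb≤z
  ... | inj₁ qa≤qb = ≤F-total-below (≤F-trans a≤qa qa≤qb) b≤qb
  ... | inj₂ qb≤qa = ≤F-total-below a≤qa (≤F-trans b≤qb qb≤qa)

  module _ (acyclic : IsForest par) where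

    ≤F? : ∀ a t → Dec (par ⊢ a ≤F t)
    ≤F? a t = map′ (λ (d , _ , eq) → d , eq) (λ (d , eq) → d , below-root d eq , eq)
      (anyUpTo? (λ d → ≡-dec _≟_ (anc par d t) (just a)) (proj₁ (acyclic t)))
      where
      below-root : ∀ d → anc par d t ≡ just a → d < proj₁ (acyclic t)
      below-root d eq = ≰⇒> λ D≤d →
        contradiction (trans (sym eq) (anc-beyond-root (proj₂ (acyclic t)) D≤d)) λ ()

    CommonAncestorAt : Fin p → Fin p → ℕ → Set
    CommonAncestorAt s t d = ∃[ a ] (anc par d s ≡ just a × par ⊢ a ≤F t)

    common-ancestor-at? : ∀ s t d → Dec (CommonAncestorAt s t d)
    common-ancestor-at? s t d with anc par d s
    ... | nothing = no λ { (_ , () , _) }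
    ... | just a = map′ (λ a≤t → a , refl , a≤t) (λ { (_ , refl , a≤t) → a≤t })
      (≤F? a t)

    -- The lcv is the common ancestor closest to s.
    lcv-exists : ∀ {s t c} → par ⊢ c ≤F s → par ⊢ c ≤F t → ∃[ l ] IsLcv par s t l
    lcv-exists {s} {t} (d₀ , s↦c) c≤t
      with d , (l , s↦l , l≤t) , closest ← least-witness (common-ancestor-at? s t) {d₀} (_ , s↦c , c≤t)
      = l , (d , s↦l) , l≤t , λ q (e , s↦q) q≤t →
          ≤F-by-distance {d = e} s↦l s↦q (≮⇒≥ λ e<d → closest e<d (q , s↦q , q≤t))

  SharedCoveredBelow : ∀ {n} → (Fin p → Subset n) → Set
  SharedCoveredBelow {n} Γ̂ =
    ∀ s t (v : Fin n) → v ∈ Γ̂ s → v ∈ Γ̂ t →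
      ∃[ c ] (par ⊢ c ≤F s × par ⊢ c ≤F t × ∃[ q ] (par ⊢ q ≤F c × v ∈ Γ̂ q))

  lcv-condition : ∀ {n} {Γ̂ : Fin p → Subset n} → IsForest par → SharedCoveredBelow Γ̂ →
    ∀ s t → (∃[ v ] (v ∈ Γ̂ s × v ∈ Γ̂ t)) →
      ∃[ l ] (IsLcv par s t l × (∀ v → v ∈ Γ̂ s → v ∈ Γ̂ t → ∃[ q ] (par ⊢ q ≤F l × v ∈ Γ̂ q)))
  lcv-condition acyclic covered s t (v , v∈s , v∈t)
    with c , c≤s , c≤t , _ ← covered s t v v∈s v∈t
    with l , lcv@(_ , _ , maximal) ← lcv-exists acyclic c≤s c≤t
    = l , lcv , λ w w∈s w∈t →
        let (c' , c'≤s , c'≤t , q , q≤c' , w∈q) = covered s t w w∈s w∈t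
        in q , ≤F-trans q≤c' (maximal c' c'≤s c'≤t) , w∈q

  total⇒shared-covered : ∀ {n} {Γ̂ : Fin p → Subset n} →
    (∀ s t → par ⊢ s ≤F t ⊎ par ⊢ t ≤F s) → SharedCoveredBelow Γ̂
  total⇒shared-covered total s t v v∈s v∈t with total s t
  ... | inj₁ s≤t = s , ≤F-refl s , s≤t , s , ≤F-refl s , v∈s
  ... | inj₂ t≤s = t , t≤s , ≤F-refl t , t , ≤F-refl t , v∈t

shared-covered : ∀ {n m} {H : Hypergraph n m} (F : EliminationForest H) →
  Forest.SharedCoveredBelow (parent F) (Γ̂ F)
shared-covered F s t v v∈s v∈t
  with l , (l≤s , l≤t , _) , covered ← cond3 F s t (v , v∈s , v∈t)
  = l , l≤s , l≤t , covered v v∈s v∈t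

comprehension : ∀ {n} {P : Fin n → Set} → (∀ x → Dec (P x)) → Subset n
comprehension P? = tabulate (λ x → does (P? x))

module _ {n} {P : Fin n → Set} (P? : ∀ x → Dec (P x)) {x : Fin n} where

  ∈-comprehension⁺ : P x → x ∈ comprehension P?
  ∈-comprehension⁺ px = lookup⇒[]= x _ (trans (lookup∘tabulate _ x) (dec-true (P? x) px))

  ∈-comprehension⁻ : x ∈ comprehension P? → P x
  ∈-comprehension⁻ x∈ = witness (P? x) (trans (sym (lookup∘tabulate _ x)) ([]=⇒lookup x∈))
    where
    witness : (x? : Dec (P x)) → does x? ≡ true → P x
    witness (yes px) _ = px
    witness (no _) ()

module Pump {n m} (H : Hypergraph n m) (e₀ : Fin m) where

  ∈-pump-new⁺ : zero ∈ β (pump H e₀) e₀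
  ∈-pump-new⁺ with e₀ ≟ e₀
  ... | yes _ = here
  ... | no e₀≢e₀ = ⊥-elim (e₀≢e₀ refl)

  ∈-pump-new⁻ : ∀ {e} → zero ∈ β (pump H e₀) e → e ≡ e₀
  ∈-pump-new⁻ {e} zero∈e with e ≟ e₀
  ... | yes e≡e₀ = e≡e₀
  ∈-pump-new⁻ () | no _

  ∈-pump-old⁻ : ∀ {e v} → suc v ∈ β (pump H e₀) e → v ∈ β H e
  ∈-pump-old⁻ (there v∈e) = v∈e

pump-strict : ∀ {n m} {H : Hypergraph n m} (F : EliminationForest H) → IsStrict {H = H} F →
  (e₀ : Fin m) → EliminationForest (pump H e₀)
pump-strict {H = H} F (injective , surjective) e₀ = record
  { p = p F ; parent = parent F ; forest = forest F ; Γ = Γ F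
  ; cond1 = covering
  ; cond2 = λ e → let (t , Γt≡e) = surjective e in
      t , t , ≤F-refl t , λ v v∈e →
        t , ≤F-refl t , ≤F-refl t , subst (λ e → v ∈ β (pump H e₀) e) (sym Γt≡e) v∈e
  ; cond3 = lcv-condition (forest F) covered
  }
  where
  open Forest (parent F)
  open Pump H e₀

  covering : ∀ v → ∃[ t ] (v ∈ β (pump H e₀) (Γ F t))
  covering zero = let (t , Γt≡e₀) = surjective e₀ in
    t , subst (λ e → zero ∈ β (pump H e₀) e) (sym Γt≡e₀) ∈-pump-new⁺
  covering (suc v) = let (t , v∈t) = cond1 F v in t , there v∈t

  covered : SharedCoveredBelow (λ t → β (pump H e₀) (Γ F t))
  covered s t zero v∈s v∈t
    with refl ← injective s t (trans (∈-pump-new⁻ v∈s) (sym (∈-pump-new⁻ v∈t)))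
    = s , ≤F-refl s , ≤F-refl s , s , ≤F-refl s , v∈s
  covered s t (suc v) v∈s v∈t =
    let (c , c≤s , c≤t , q , q≤c , v∈q) = shared-covered F s t v (∈-pump-old⁻ v∈s) (∈-pump-old⁻ v∈t)
    in c , c≤s , c≤t , q , q≤c , there v∈q

-- Condition (2) for e puts x and y on one root path, so the two common ancestors obtained
-- from condition (3) are comparable and the lower one serves s and t.
edge-covered-below : ∀ {n m} {H : Hypergraph n m} (F : EliminationForest H) {e x y s t} →
  x ∈ β H e → y ∈ β H e → x ∈ Γ̂ F s → y ∈ Γ̂ F t →
  ∃[ c ] (parent F ⊢ c ≤F s × parent F ⊢ c ≤F t ×
          ∃[ q ] (parent F ⊢ q ≤F c × (x ∈ Γ̂ F q ⊎ y ∈ Γ̂ F q)))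
edge-covered-below F {e} {x} {y} {s} {t} x∈e y∈e x∈s y∈t
  with _ , t₀ , _ , path ← cond2 F e
  with qx , _ , qx≤t₀ , x∈qx ← path x x∈e
  with qy , _ , qy≤t₀ , y∈qy ← path y y∈e
  with cx , cx≤s , cx≤qx , rx , rx≤cx , x∈rx ← shared-covered F s qx x x∈s x∈qx
  with cy , cy≤qy , cy≤t , ry , ry≤cy , y∈ry ← shared-covered F qy t y y∈qy y∈t
  with Forest.≤F-total-below₂ (parent F) cx≤qx cy≤qy qx≤t₀ qy≤t₀
... | inj₁ cx≤cy = cx , cx≤s , Forest.≤F-trans (parent F) cx≤cy cy≤t , rx , rx≤cx , inj₁ x∈rx
... | inj₂ cy≤cx = cy , Forest.≤F-trans (parent F) cy≤cx cx≤s , cy≤t , ry , ry≤cy , inj₂ y∈ry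

merge-forest : ∀ {n n' m} {H : Hypergraph n m} {H' : Hypergraph n' m} →
  IsLocalMerge H H' → EliminationForest H → EliminationForest H'
merge-forest {H = H} {H'} (e₀ , u , v , _ , u∈e₀ , v∈e₀ , f , fibres , surjective , image) F = record
  { p = p F ; parent = parent F ; forest = forest F ; Γ = Γ F
  ; cond1 = λ w → let (x , fx≡w) = surjective w ; (t , x∈t) = cond1 F x in t , ↦∈ x∈t fx≡w
  ; cond2 = λ e → let (s , t , s≤t , path) = cond2 F e in
      s , t , s≤t , λ w w∈e → let (x , x∈e , fx≡w) = to (image e w) w∈e
                                  (q , s≤q , q≤t , x∈q) = path x x∈e
                              in q , s≤q , q≤t , ↦∈ x∈q fx≡w
  ; cond3 = lcv-condition (forest F) covered
  }
  where
  open Forest (parent F)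

  ↦∈ : ∀ {e x w} → x ∈ β H e → f x ≡ w → w ∈ β H' e
  ↦∈ x∈e fx≡w = from (image _ _) (_ , x∈e , fx≡w)

  covered : SharedCoveredBelow (λ t → β H' (Γ F t))
  covered s t w w∈s w∈t
    with x , x∈s , fx≡w ← to (image (Γ F s) w) w∈s
    with y , y∈t , fy≡w ← to (image (Γ F t) w) w∈t
    with to (fibres x y) (trans fx≡w (sym fy≡w))
  ... | inj₁ refl =
    let (c , c≤s , c≤t , q , q≤c , x∈q) = shared-covered F s t x x∈s y∈t
    in c , c≤s , c≤t , q , q≤c , ↦∈ x∈q fx≡w
  ... | inj₂ merged =
    let (x∈e₀ , y∈e₀) = in-merged-edge merged
        (c , c≤s , c≤t , q , q≤c , x∈q⊎y∈q) = edge-covered-below F x∈e₀ y∈e₀ x∈s y∈t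
    in c , c≤s , c≤t , q , q≤c , [ (λ x∈q → ↦∈ x∈q fx≡w) , (λ y∈q → ↦∈ y∈q fy≡w) ]′ x∈q⊎y∈q
    where
    in-merged-edge : (x ≡ u × y ≡ v) ⊎ (x ≡ v × y ≡ u) → x ∈ β H e₀ × y ∈ β H e₀
    in-merged-edge (inj₁ (refl , refl)) = u∈e₀ , v∈e₀
    in-merged-edge (inj₂ (refl , refl)) = v∈e₀ , u∈e₀

PairVertices : ∀ {n m} → Hypergraph n m → Set
PairVertices {n} {m} H =
  ∀ (i j : Fin m) → ∃[ v ] (v ∈ β H i × v ∈ β H j × (∀ e → v ∈ β H e → e ≡ i ⊎ e ≡ j))

module _ {n m} {H : Hypergraph n m} (pairs : PairVertices H) (F : EliminationForest H) where
  open Forest (parent F)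

  LabelBelow : Fin (p F) → Fin m → Set
  LabelBelow t e = ∃[ q ] (parent F ⊢ q ≤F t × Γ F q ≡ e)

  label-below? : ∀ t e → Dec (LabelBelow t e)
  label-below? t e = any? λ q → ≤F? (forest F) q t ×-dec Γ F q ≟ e

  label-occurs : ∀ e → ∃[ t ] (Γ F t ≡ e)
  label-occurs e
    with v , v∈e , _ , only-e ← pairs e e
    with t , v∈t ← cond1 F v
    = t , reduce (only-e (Γ F t) v∈t)

  common-ancestor-labelled : ∀ a b →
    ∃[ q ] (parent F ⊢ q ≤F a × parent F ⊢ q ≤F b × (Γ F q ≡ Γ F a ⊎ Γ F q ≡ Γ F b))
  common-ancestor-labelled a b
    with v , v∈a , v∈b , only-ab ← pairs (Γ F a) (Γ F b)
    with c , c≤a , c≤b , q , q≤c , v∈q ← shared-covered F a b v v∈a v∈b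
    = q , ≤F-trans q≤c c≤a , ≤F-trans q≤c c≤b , only-ab (Γ F q) v∈q

  labels-on-one-path : Fin (p F) → ∀ es → ∃[ t ] All (LabelBelow t) es
  labels-on-one-path t₀ [] = t₀ , []
  labels-on-one-path t₀ (e ∷ es)
    with t , below-t ← labels-on-one-path t₀ es
    with label-below? t e
  ... | yes e-below-t = t , e-below-t ∷ below-t
  ... | no e-not-below-t
    with b , Γb≡e ← label-occurs e
    = b , (b , ≤F-refl b , Γb≡e) ∷ All.map move below-t
    where
    move : ∀ {i} → LabelBelow t i → LabelBelow b i
    move (a , a≤t , refl) with common-ancestor-labelled a b
    ... | q , _ , q≤b , inj₁ Γq≡Γa = q , q≤b , Γq≡Γa
    ... | q , q≤a , _ , inj₂ Γq≡Γb =
      contradiction (q , ≤F-trans q≤a a≤t , trans Γq≡Γb Γb≡e) e-not-below-t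

  labels-≤-height : ∀ {h t} → HeightAtMost (parent F) h → (∀ e → LabelBelow t e) → m ≤ h
  labels-≤-height {h} {t} height below = injective⇒≤ {f = level} level-injective
    where
    node : Fin m → Fin (p F)
    node e = proj₁ (below e)

    node-label : ∀ e → Γ F (node e) ≡ e
    node-label e = proj₂ (proj₂ (below e))

    depth : Fin m → ℕ
    depth e = proj₁ (proj₁ (proj₂ (below e)))

    t↦node : ∀ e → anc (parent F) (depth e) t ≡ just (node e)
    t↦node e = proj₂ (proj₁ (proj₂ (below e)))

    depth<h : ∀ e → depth e < h
    depth<h e = ≰⇒> λ h≤d →
      contradiction (trans (sym (t↦node e)) (anc-beyond-root (height t) h≤d)) λ ()

    level : Fin m → Fin h
    level e = fromℕ< (depth<h e)

    level-injective : Injective _≡_ _≡_ level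
    level-injective {i} {j} same-level = begin
      i              ≡⟨ sym (node-label i) ⟩
      Γ F (node i)   ≡⟨ cong (Γ F) (just-injective same-node) ⟩
      Γ F (node j)   ≡⟨ node-label j ⟩
      j              ∎
      where
      open ≡-Reasoning
      same-node : just (node i) ≡ just (node j)
      same-node = begin
        just (node i)                 ≡⟨ sym (t↦node i) ⟩
        anc (parent F) (depth i) t    ≡⟨ cong (λ d → anc (parent F) d t)
                                              (fromℕ<-injective _ _ (depth<h i) (depth<h j) same-level) ⟩
        anc (parent F) (depth j) t    ≡⟨ t↦node j ⟩
        just (node j)                 ∎

edges-≤-height : ∀ {n m h} {H : Hypergraph n m} → PairVertices H →
  (F : EliminationForest H) → HeightAtMost (parent F) h → m ≤ h
edges-≤-height {m = zero} _ _ _ = z≤n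
edges-≤-height {m = suc _} pairs F height =
  let (t₀ , _) = label-occurs pairs F zero
      (t , below) = labels-on-one-path pairs F t₀ (allFin _)
  in labels-≤-height pairs F height λ e → All.lookup below (∈-allFin e)

chain : ∀ {k} → Fin k → Maybe (Fin k)
chain zero = nothing
chain (suc i) = just (inject₁ i)

module _ {k : ℕ} where
  open Forest (chain {k})

  chain-anc : ∀ d {s t : Fin k} → toℕ s + d ≡ toℕ t → anc chain d t ≡ just s
  chain-anc zero eq = cong just (sym (toℕ-injective (trans (sym (+-identityʳ _)) eq)))
  chain-anc (suc d) {s} {zero} eq = contradiction (trans (sym (+-suc (toℕ s) d)) eq) λ ()
  chain-anc (suc d) {s} {suc i} eq = trans (anc-suc d (suc i))
    (chain-anc d (trans (suc-injective (trans (sym (+-suc (toℕ s) d)) eq)) (sym (toℕ-inject₁ i))))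

  chain-≤F : ∀ {s t : Fin k} → toℕ s ≤ toℕ t → chain ⊢ s ≤F t
  chain-≤F {s} {t} s≤t = toℕ t ∸ toℕ s , chain-anc _ (m+[n∸m]≡n s≤t)

  chain-total : ∀ s t → chain ⊢ s ≤F t ⊎ chain ⊢ t ≤F s
  chain-total s t with ≤-total (toℕ s) (toℕ t)
  ... | inj₁ s≤t = inj₁ (chain-≤F s≤t)
  ... | inj₂ t≤s = inj₂ (chain-≤F t≤s)

  chain-anc-nothing : ∀ d (t : Fin k) → toℕ t < d → anc chain d t ≡ nothing
  chain-anc-nothing (suc d) zero _ = anc-suc d zero
  chain-anc-nothing (suc d) (suc i) i<d = trans (anc-suc d (suc i))
    (chain-anc-nothing d (inject₁ i) (subst (_< d) (sym (toℕ-inject₁ i)) (s≤s⁻¹ i<d)))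

  chain-height : HeightAtMost (chain {k}) k
  chain-height t = chain-anc-nothing k t (toℕ<n t)

  chain-forest : IsForest (chain {k})
  chain-forest t = k , chain-height t

-- Hyperedges 0, …, k; the vertex combine i j stands for the pair (i, j).
module _ {k : ℕ} where

  Incident : Fin (suc k) → Fin (suc k) → Fin (suc k) → Set
  Incident e i j = e ≡ i ⊎ e ≡ j ⊎ (i ≡ zero × j ≡ zero)

  incident? : ∀ e i j → Dec (Incident e i j)
  incident? e i j = e ≟ i ⊎-dec e ≟ j ⊎-dec (i ≟ zero ×-dec j ≟ zero)

  pair : Fin (suc k * suc k) → Fin (suc k) × Fin (suc k)
  pair = remQuot (suc k)

  incident-vertex? : ∀ e w → Dec (Incident e (proj₁ (pair w)) (proj₂ (pair w)))
  incident-vertex? e w = incident? e (proj₁ (pair w)) (proj₂ (pair w))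

  clique : Hypergraph (suc k * suc k) (suc k)
  clique = record
    { β = λ e → comprehension (incident-vertex? e)
    ; cover = λ w → proj₁ (pair w) , ∈-comprehension⁺ (incident-vertex? _) (inj₁ refl)
    }

  ∈-clique : ∀ {e i j} → combine i j ∈ β clique e ⇔ Incident e i j
  ∈-clique {e} {i} {j} = mk⇔
    (λ ij∈e → subst (λ (i' , j') → Incident e i' j') (remQuot-combine i j)
                (∈-comprehension⁻ (incident-vertex? e) ij∈e))
    (λ incident → ∈-comprehension⁺ (incident-vertex? e)
                    (subst (λ (i' , j') → Incident e i' j') (sym (remQuot-combine i j)) incident))

  open Pump clique zero

  pair-vertex : ∀ i j → ¬ (i ≡ zero × j ≡ zero) → ∃[ v ] (v ∈ β (pump clique zero) i ×
    v ∈ β (pump clique zero) j × (∀ e → v ∈ β (pump clique zero) e → e ≡ i ⊎ e ≡ j))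
  pair-vertex i j not-both-zero =
    suc (combine i j) , there (from (∈-clique {i} {i} {j}) (inj₁ refl)) ,
    there (from (∈-clique {j} {i} {j}) (inj₂ (inj₁ refl))) ,
    λ e ij∈e → only-i-j (to (∈-clique {e}) (∈-pump-old⁻ ij∈e))
    where
    only-i-j : ∀ {e} → Incident e i j → e ≡ i ⊎ e ≡ j
    only-i-j (inj₁ e≡i) = inj₁ e≡i
    only-i-j (inj₂ (inj₁ e≡j)) = inj₂ e≡j
    only-i-j (inj₂ (inj₂ both-zero)) = contradiction both-zero not-both-zero

  pumped-clique-pair-vertices : PairVertices (pump clique zero)
  pumped-clique-pair-vertices zero zero =
    zero , ∈-pump-new⁺ , ∈-pump-new⁺ , λ e new∈e → inj₁ (∈-pump-new⁻ new∈e)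
  pumped-clique-pair-vertices zero (suc j) = pair-vertex zero (suc j) λ { (_ , ()) }
  pumped-clique-pair-vertices (suc i) j = pair-vertex (suc i) j λ { (() , _) }

-- The chain 0 → … → k-1 with node t labelled by the hyperedge t+1; hyperedge 0 stays unused.
clique-∈-HD : ∀ {k} → 1 ≤ k → HD k (clique {k})
clique-∈-HD {suc k} _ = record
  { p = suc k ; parent = chain ; forest = chain-forest ; Γ = suc
  ; cond1 = covering
  ; cond2 = λ e → zero , fromℕ k , chain-≤F z≤n , λ w _ → let (t , w∈t) = covering w in
      t , chain-≤F z≤n , chain-≤F (≤fromℕ t) , w∈t
  ; cond3 = Forest.lcv-condition chain chain-forest (Forest.total⇒shared-covered chain chain-total)
  } , chain-height
  where
  labelled-node : ∀ i j → ∃[ t ] Incident (suc t) i j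
  labelled-node (suc i) j = i , inj₁ refl
  labelled-node zero (suc j) = j , inj₂ (inj₁ refl)
  labelled-node zero zero = zero , inj₂ (inj₂ (refl , refl))

  covering : ∀ w → ∃[ t ] (w ∈ β clique (suc t))
  covering w = let (t , incident) = labelled-node (proj₁ (pair w)) (proj₂ (pair w))
               in t , ∈-comprehension⁺ (incident-vertex? (suc t)) incident

proposition2p8 : ∀ (k : ℕ) → 1 ≤ k →
    ClosedUnderPumping (SHD k) × ClosedUnderLocalMerging (SHD k) ×
    ClosedUnderLocalMerging (HD k) × ¬ ClosedUnderPumping (HD k)
proposition2p8 k 1≤k =
  (λ H (F , strict , height) e → pump-strict F strict e , strict , height) ,
  (λ H H' (F , strict , height) merge → merge-forest merge F , strict , height) ,
  (λ H H' (F , height) merge → merge-forest merge F , height) ,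
  λ closed → let (F , height) = closed clique (clique-∈-HD 1≤k) zero
             in <-irrefl refl (edges-≤-height pumped-clique-pair-vertices F height)
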